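{- Let $D\ge2$ be squarefree, $K=\mathbb{Q}(\sqrt D)$ with discriminant $\Delta$. If $\alpha=e\alpha_{i,r}+f\alpha_{i,r+1}$ with $i\ge-1$ odd, $0\le r\le u_{i+2}-1$, $e\ge1$ and $f\ge0$ integers, then \[ \mathrm{N}(\alpha)<\sqrt{\Delta}\left((u_{i+2}-r+2)e+(u_{i+2}-r+1)f\right)\left((u_{i+2}-r+1)e+(u_{i+2}-r)f\right). \]
   Context: $\mathrm{N}(\alpha)=\alpha\alpha'$ with $\alpha'$ the Galois conjugate; $\Delta=D$ if $D\equiv1\pmod4$ and $\Delta=4D$ otherwise. Notation: $\omega_D=\sqrt D$, $\xi_D=\sqrt D$ if $D\equiv2,3\pmod4$; $\omega_D=(1+\sqrt D)/2$, $\xi_D=(\sqrt D-1)/2$ if $D\equiv1\pmod4$. Write $\omega_D=[\lceil u_0/2\rceil;\overline{u_1,\dots,u_s}]$ with $u_s=u_0$ (indices extended periodically). Let $p_{ -1}=1,q_{ -1}=0$, $p_0=\lceil u_0/2\rceil,q_0=1$, $p_{i+2}=u_{i+2}p_{i+1}+p_i$, $q_{i+2}=u_{i+2}q_{i+1}+q_i$, $\alpha_i=p_i+q_i\xi_D$, $\alpha_{i,r}=\alpha_i+r\alpha_{i+1}$. -}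

module Defs where

open import Data.Bool using (Bool; true; false; if_then_else_)
open import Data.Nat as ℕ using (ℕ; zero; suc; _%_; _/_; _≡ᵇ_)
open import Data.Nat.Divisibility using (_∣_)
open import Data.Integer as ℤ using (ℤ; +_; _-_; _*_; _+_; _<_; _≤_)
open import Data.Product using (Σ; _×_; _,_; ∃)
open import Data.Sum using (_⊎_)
open import Relation.Binary.PropositionalEquality using (_≡_)

SquareFree : ℕ → Set
SquareFree D = ∀ (m : ℕ) → (m ℕ.* m) ∣ D → m ≡ 1

isOneMod4 : ℕ → Bool
isOneMod4 D = (D % 4) ≡ᵇ 1

disc : ℕ → ℕ
disc D = if isOneMod4 D then D else 4 ℕ.* D

-- x < √d · m
LtSqrtMul : ℤ → ℕ → ℕ → Set
LtSqrtMul x d m = (x < + 0) ⊎ ((+ 0 ≤ x) × (x * x < + (d ℕ.* (m ℕ.* m))))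

LeSqrt : ℤ → ℕ → Set
LeSqrt x d = (x ≤ + 0) ⊎ (x * x ≤ + d)

SqrtLt : ℕ → ℤ → Set
SqrtLt d y = (+ 0 < y) × (+ d < y * y)

-- Continued fraction expansion of a quadratic irrational (P₀ + √D)/Q₀
-- (Q₀ > 0), via the standard complete-quotient recursion
--   x_k = (P_k + √D)/Q_k ,  a_k = ⌊x_k⌋ ,  x_{k+1} = 1/(x_k - a_k),
-- i.e. P_{k+1} = a_k Q_k - P_k ,  Q_k Q_{k+1} = D - P_{k+1}^2 .
-- "a_k = ⌊(P_k+√D)/Q_k⌋" is  a_k Q_k - P_k ≤ √D < (a_k+1) Q_k - P_k .

IsFloor : ℕ → ℤ → ℕ → ℕ → Set
IsFloor a P Q D =
  LeSqrt (+ a * + Q - P) D × SqrtLt D (+ (suc a) * + Q - P)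

IsCFExpansion : ℤ → ℕ → ℕ → (ℕ → ℕ) → Set
IsCFExpansion P₀ Q₀ D a =
  Σ (ℕ → ℤ) λ P → Σ (ℕ → ℕ) λ Q →
    (P 0 ≡ P₀) × (Q 0 ≡ Q₀) ×
    (∀ k → (0 ℕ.< Q k)
         × IsFloor (a k) (P k) (Q k) D
         × (P (suc k) ≡ + a k * + Q k - P k)
         × (+ Q k * + Q (suc k) ≡ + D - P (suc k) * P (suc k)))

-- ω_D = √D  (D ≢ 1 mod 4),  ω_D = (1+√D)/2  (D ≡ 1 mod 4)
ωP : ℕ → ℤ
ωP D = if isOneMod4 D then + 1 else + 0

ωQ : ℕ → ℕ
ωQ D = if isOneMod4 D then 2 else 1

-- a is the sequence of partial quotients of ω_D:  ω_D = [a 0; a 1, a 2, …].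
-- In the paper's notation  a 0 = ⌈u₀/2⌉  and  a j = u_j  for j ≥ 1.
IsCFω : ℕ → (ℕ → ℕ) → Set
IsCFω D a = IsCFExpansion (ωP D) (ωQ D) D a

-- Elements of O_K written as x + y ξ_D, represented by (x , y).

Elt : Set
Elt = ℤ × ℤ

_⊕_ : Elt → Elt → Elt
(x , y) ⊕ (x' , y') = (x + x' , y + y')

_⊙_ : ℕ → Elt → Elt
n ⊙ (x , y) = (+ n * x , + n * y)

-- Norm N(x + y ξ_D):
--   D ≢ 1 (mod 4):  ξ = √D,         N = x² - D y²
--   D ≡ 1 (mod 4):  ξ = (√D - 1)/2, N = x² - x y - ((D-1)/4) y²   ((D-1)/4 = D / 4)
norm : ℕ → Elt → ℤ
norm D (x , y) =
  if isOneMod4 D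
  then x * x - x * y - + (D / 4) * (y * y)
  else x * x - + D * (y * y)

-- Convergents, with index shifted by one:  pp a n = p_{n-1}, qq a n = q_{n-1}.

pp : (ℕ → ℕ) → ℕ → ℕ
pp a zero = 1
pp a (suc zero) = a 0
pp a (suc (suc j)) = a (suc j) ℕ.* pp a (suc j) ℕ.+ pp a j

qq : (ℕ → ℕ) → ℕ → ℕ
qq a zero = 0
qq a (suc zero) = 1
qq a (suc (suc j)) = a (suc j) ℕ.* qq a (suc j) ℕ.+ qq a j

-- αs a n = α_{n-1} = p_{n-1} + q_{n-1} ξ_D
αs : (ℕ → ℕ) → ℕ → Elt
αs a n = (+ pp a n , + qq a n)

-- αsr a n r = α_{n-1, r} = α_{n-1} + r α_n
αsr : (ℕ → ℕ) → ℕ → ℕ → Elt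
αsr a n r = αs a n ⊕ (r ⊙ αs a (suc n))

-- Write m = i + 1 (even) and α = A α_{m-1} + B α_m with A = e + f, B = (e + f) r + f.  A step of the
-- continued fraction turns (A, B) into (B, A + a_{m+1} B), and induction along the expansion gives
-- Q₀ N(A α_{m-1} + B α_m) = (−1)^m f_m(A, B) for the form f_m(A, B) = Q_m A² + 2 P_{m+1} A B − Q_{m+1} B²
-- of the complete quotient x_{m+1} = (P_{m+1} + √D)/Q_{m+1}.  Multiplied by Q_{m+1}, f_m(A, B) becomes
-- D A² − L² with L = Q_{m+1} B − P_{m+1} A, and AM-GM bounds this by 2√D·A·(cA − L) for every c > √D.
-- Taking c = (a_{m+1} + 1) Q_{m+1} − P_{m+1}, which exceeds √D because a_{m+1} = ⌊x_{m+1}⌋, gives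
-- cA − L = Q_{m+1}((u − r + 1)e + (u − r)f) where u = a_{m+1}.  As 4D = Δ Q₀², this is
-- N(α) < √Δ · A · ((u − r + 1)e + (u − r)f), and A ≤ (u − r + 2)e + (u − r + 1)f.
module Submission where

open import Defs

module SquareRootComparison where
  open import Data.Integer.Base
    using (ℤ; +_; -[1+_]; 0ℤ; _+_; _*_; _-_; _≤_; _<_; +≤+; nonNegative; positive)
  open import Data.Integer.Properties
  open import Data.Integer.Tactic.RingSolver using (solve-∀)
  open import Data.Nat.Base as ℕ using (z≤n)
  open import Data.Product.Base using (_×_; _,_)
  open import Data.Sum.Base using (_⊎_; inj₁; inj₂)
  open import Relation.Nullary.Decidable.Core using (yes; no)
  open import Relation.Nullary.Negation.Core using (contradiction)
  open import Relation.Binary.PropositionalEquality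

  0≤i*i : ∀ i → 0ℤ ≤ i * i
  0≤i*i (+ n)     = subst (0ℤ ≤_) (pos-* n n) (+≤+ z≤n)
  0≤i*i -[1+ n ]  = +≤+ z≤n

  0≤i*j : ∀ {i j} → 0ℤ ≤ i → 0ℤ ≤ j → 0ℤ ≤ i * j
  0≤i*j {i} 0≤i 0≤j = subst (_≤ i * _) (*-zeroʳ i) (*-monoˡ-≤-nonNeg i ⦃ nonNegative 0≤i ⦄ 0≤j)

  0<i*j : ∀ {i j} → 0ℤ < i → 0ℤ < j → 0ℤ < i * j
  0<i*j {i} 0<i 0<j = subst (_< i * _) (*-zeroʳ i) (*-monoˡ-<-pos i ⦃ positive 0<i ⦄ 0<j)

  i≤j⇒i*i≤j*j : ∀ {i j} → 0ℤ ≤ i → i ≤ j → i * i ≤ j * j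
  i≤j⇒i*i≤j*j {i} {j} 0≤i i≤j =
    ≤-trans (*-monoˡ-≤-nonNeg i ⦃ nonNegative 0≤i ⦄ i≤j)
            (*-monoʳ-≤-nonNeg j ⦃ nonNegative (≤-trans 0≤i i≤j) ⦄ i≤j)

  i<j⇒i*i<j*j : ∀ {i j} → 0ℤ ≤ i → i < j → i * i < j * j
  i<j⇒i*i<j*j {i} {j} 0≤i i<j =
    ≤-<-trans (*-monoˡ-≤-nonNeg i ⦃ nonNegative 0≤i ⦄ (<⇒≤ i<j))
              (*-monoʳ-<-pos j ⦃ positive (≤-<-trans 0≤i i<j) ⦄ i<j)

  *-square : ∀ i j → i * j * (i * j) ≡ i * i * (j * j)
  *-square = solve-∀

  i-j+j≡i : ∀ i j → i - j + j ≡ i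
  i-j+j≡i = solve-∀

  i*i<j*j⇒i<j : ∀ {i j} → 0ℤ ≤ j → i * i < j * j → i < j
  i*i<j*j⇒i<j {i} {j} 0≤j i²<j² with i <? j
  ... | yes i<j = i<j
  ... | no  i≮j = contradiction i²<j² (≤⇒≯ (i≤j⇒i*i≤j*j 0≤j (≮⇒≥ i≮j)))

  infix 4 _<√[_]·_

  -- x < √d · y, for 0 ≤ d and 0 ≤ y, without square roots.
  _<√[_]·_ : ℤ → ℤ → ℤ → Set
  x <√[ d ]· y = x < 0ℤ ⊎ (0ℤ ≤ x × x * x < d * (y * y))

  <√-resp : ∀ {x d y d′ y′} → d * (y * y) ≡ d′ * (y′ * y′) → x <√[ d ]· y → x <√[ d′ ]· y′
  <√-resp eq (inj₁ x<0)         = inj₁ x<0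
  <√-resp eq (inj₂ (0≤x , x²<)) = inj₂ (0≤x , subst (_ <_) eq x²<)

  <√-monoʳ : ∀ {x d y y′} → 0ℤ ≤ d → 0ℤ ≤ y → y ≤ y′ → x <√[ d ]· y → x <√[ d ]· y′
  <√-monoʳ 0≤d 0≤y y≤y′ (inj₁ x<0)         = inj₁ x<0
  <√-monoʳ {d = d} 0≤d 0≤y y≤y′ (inj₂ (0≤x , x²<)) =
    inj₂ (0≤x , <-≤-trans x²< (*-monoˡ-≤-nonNeg d ⦃ nonNegative 0≤d ⦄ (i≤j⇒i*i≤j*j 0≤y y≤y′)))

  *-cancelˡ-<√ : ∀ {q x d y} → 0ℤ < q → q * x <√[ d ]· q * y → x <√[ d ]· y
  *-cancelˡ-<√ {q} {x} {d} {y} 0<q (inj₁ qx<0) =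
    inj₁ (*-cancelˡ-<-nonNeg q ⦃ nonNegative (<⇒≤ 0<q) ⦄ (subst (q * x <_) (sym (*-zeroʳ q)) qx<0))
  *-cancelˡ-<√ {q} {x} {d} {y} 0<q (inj₂ (0≤qx , qx²<)) =
    inj₂ ( *-cancelˡ-≤-pos 0ℤ x q ⦃ positive 0<q ⦄ (subst (_≤ q * x) (sym (*-zeroʳ q)) 0≤qx)
         , *-cancelˡ-<-nonNeg (q * q) ⦃ nonNegative (0≤i*i q) ⦄ (subst₂ _<_ (*-square q x) (scale q d y) qx²<))
    where
    scale : ∀ q d y → d * (q * y * (q * y)) ≡ q * q * (d * (y * y))
    scale = solve-∀

  <√-rescale : ∀ {x d k d′ q y} → d * (k * k) ≡ d′ * (q * q) → x <√[ d ]· k * y → x <√[ d′ ]· q * y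
  <√-rescale {d = d} {k} {d′} {q} {y} dk²≡d′q² = <√-resp {d = d} {y = k * y} {d′ = d′} {y′ = q * y} (begin
    d * (k * y * (k * y))   ≡⟨ cong (d *_) (*-square k y) ⟩
    d * (k * k * (y * y))   ≡⟨ *-assoc d (k * k) (y * y) ⟨
    d * (k * k) * (y * y)   ≡⟨ cong (_* (y * y)) dk²≡d′q² ⟩
    d′ * (q * q) * (y * y)  ≡⟨ *-assoc d′ (q * q) (y * y) ⟩
    d′ * (q * q * (y * y))  ≡⟨ cong (d′ *_) (*-square q y) ⟨
    d′ * (q * y * (q * y))  ∎)
    where open ≡-Reasoning

  <√⇒LtSqrtMul : ∀ {x d m} → x <√[ + d ]· + m → LtSqrtMul x d m
  <√⇒LtSqrtMul (inj₁ x<0)         = inj₁ x<0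
  <√⇒LtSqrtMul {d = d} {m} (inj₂ (0≤x , x²<)) =
    inj₂ (0≤x , subst (_ <_) (sym (trans (pos-* d (m ℕ.* m)) (cong (+ d *_) (pos-* m m)))) x²<)

  -- 2·D·A·L ≤ √D·(D·A² + L²) < c·(D·A² + L²) by AM-GM; both sides are squared to eliminate √D.
  2DAL<c[DA²+L²] : ∀ {D c A} L → 0ℤ < D → 0ℤ < c → D < c * c → 0ℤ < A →
                   + 2 * D * A * L < c * (D * (A * A) + L * L)
  2DAL<c[DA²+L²] {D} {c} {A} L 0<D 0<c D<c² 0<A =
    i*i<j*j⇒i<j (<⇒≤ (0<i*j 0<c 0<T)) (begin-strict
      + 2 * D * A * L * (+ 2 * D * A * L) ≤⟨ 0≤i-j⇒j≤i (subst (0ℤ ≤_) (amgm D A L) 0≤D[DA²-L²]²) ⟩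
      D * (T * T)                         <⟨ *-monoʳ-<-pos (T * T) ⦃ positive (0<i*j 0<T 0<T) ⦄ D<c² ⟩
      c * c * (T * T)                     ≡⟨ *-square c T ⟨
      c * T * (c * T)                     ∎)
    where
    open ≤-Reasoning
    T = D * (A * A) + L * L
    0<T : 0ℤ < T
    0<T = <-≤-trans (0<i*j 0<D (0<i*j 0<A 0<A)) (i≤i+j _ (L * L) ⦃ nonNegative (0≤i*i L) ⦄)
    0≤D[DA²-L²]² : 0ℤ ≤ D * ((D * (A * A) - L * L) * (D * (A * A) - L * L))
    0≤D[DA²-L²]² = 0≤i*j (<⇒≤ 0<D) (0≤i*i (D * (A * A) - L * L))
    amgm : ∀ D A L → D * ((D * (A * A) - L * L) * (D * (A * A) - L * L))
                   ≡ D * ((D * (A * A) + L * L) * (D * (A * A) + L * L)) - + 2 * D * A * L * (+ 2 * D * A * L)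
    amgm = solve-∀

  -- D·A² − L² = (√D·A − L)(√D·A + L) ≤ 2√D·A·(√D·A − L) < 2√D·A·(c·A − L).
  DA²-L²<√D·2A[cA-L] : ∀ {D c A} L → 0ℤ < D → 0ℤ < c → D < c * c → 0ℤ < A →
                       D * (A * A) - L * L <√[ D ]· + 2 * A * (c * A - L)
  DA²-L²<√D·2A[cA-L] {D} {c} {A} L 0<D 0<c D<c² 0<A with D * (A * A) - L * L <? 0ℤ
  ... | yes M<0 = inj₁ M<0
  ... | no  M≮0 = inj₂ (0≤M , *-cancelˡ-<-nonNeg D ⦃ nonNegative (<⇒≤ 0<D) ⦄ (begin-strict
    D * (M * M)       ≤⟨ *-monoʳ-≤-nonNeg (M * M) ⦃ nonNegative (0≤i*i M) ⦄ (<⇒≤ D<c²) ⟩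
    c * c * (M * M)   ≡⟨ *-square c M ⟨
    c * M * (c * M)   <⟨ i<j⇒i*i<j*j (0≤i*j (<⇒≤ 0<c) 0≤M) cM<D*y ⟩
    D * y * (D * y)   ≡⟨ *-square D y ⟩
    D * D * (y * y)   ≡⟨ *-assoc D D (y * y) ⟩
    D * (D * (y * y)) ∎))
    where
    open ≤-Reasoning
    M = D * (A * A) - L * L
    y = + 2 * A * (c * A - L)
    0≤M : 0ℤ ≤ M
    0≤M = ≮⇒≥ M≮0
    expand : ∀ D c A L → c * (D * (A * A) - L * L) - + 2 * D * A * L + c * (D * (A * A) + L * L)
                       ≡ D * (+ 2 * A * (c * A - L))
    expand = solve-∀
    cM<D*y : c * M < D * y
    cM<D*y = subst₂ _<_ (i-j+j≡i (c * M) _) (expand D c A L)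
               (+-monoʳ-< (c * M - + 2 * D * A * L) (2DAL<c[DA²+L²] L 0<D 0<c D<c² 0<A))

module ContinuedFractionNorms where
  open import Data.Bool.Base using (true; false; T)
  open import Data.Integer.Base
    using (ℤ; +_; 0ℤ; 1ℤ; -1ℤ; _+_; _*_; _-_; -_; _^_; _≤_; _<_; +≤+; +<+; >-nonZero)
  open import Data.Integer.Properties
  open import Data.Integer.Tactic.RingSolver using (solve-∀)
  open import Data.Nat.Base as ℕ using (ℕ; zero; suc; z≤n)
  import Data.Nat.Properties as ℕ
  import Data.Nat.Tactic.RingSolver as ℕ
  open import Data.Nat.DivMod using (m≡m%n+[m/n]*n)
  open import Data.Product.Base using (_×_; _,_; proj₁; proj₂)
  open import Relation.Binary.PropositionalEquality
  open ≡-Reasoning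
  open SquareRootComparison

  N√ : ℤ → ℤ → ℤ → ℤ
  N√ D u v = u * u - D * (v * v)

  -- Q₀² · N(x + y ξ) with ξ = (√D − P₀)/Q₀; for ω_D = (P₀ + √D)/Q₀ this ξ is ξ_D.
  scaledNorm : ℤ → ℕ → ℕ → Elt → ℤ
  scaledNorm P₀ Q₀ D (x , y) = N√ (+ D) (+ Q₀ * x - P₀ * y) y

  isOneMod4⇒D≡1+[D/4]*4 : ∀ {D} → isOneMod4 D ≡ true → + D ≡ 1ℤ + + (D ℕ./ 4) * + 4
  isOneMod4⇒D≡1+[D/4]*4 {D} D≡1 = begin
    + D                            ≡⟨ cong +_ (m≡m%n+[m/n]*n D 4) ⟩
    + (D ℕ.% 4 ℕ.+ D ℕ./ 4 ℕ.* 4)  ≡⟨ cong (λ n → + (n ℕ.+ D ℕ./ 4 ℕ.* 4)) D%4≡1 ⟩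
    1ℤ + + (D ℕ./ 4 ℕ.* 4)         ≡⟨ cong (λ n → 1ℤ + n) (pos-* (D ℕ./ 4) 4) ⟩
    1ℤ + + (D ℕ./ 4) * + 4         ∎
    where
    D%4≡1 : D ℕ.% 4 ≡ 1
    D%4≡1 = ℕ.≡ᵇ⇒≡ (D ℕ.% 4) 1 (subst T (sym D≡1) _)

  scaledNorm-ω : ∀ D x → scaledNorm (ωP D) (ωQ D) D x ≡ + ωQ D * + ωQ D * norm D x
  scaledNorm-ω D (x , y) with isOneMod4 D in D≡1
  ... | true  = trans (cong (λ δ → N√ δ (+ 2 * x - + 1 * y) y) (isOneMod4⇒D≡1+[D/4]*4 {D} D≡1))
                      (identity x y (+ (D ℕ./ 4)))
    where
    identity : ∀ x y m → (+ 2 * x - + 1 * y) * (+ 2 * x - + 1 * y) - (1ℤ + m * + 4) * (y * y)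
                       ≡ + 2 * + 2 * (x * x - x * y - m * (y * y))
    identity = solve-∀
  ... | false = identity x y (+ D)
    where
    identity : ∀ x y δ → (+ 1 * x - + 0 * y) * (+ 1 * x - + 0 * y) - δ * (y * y)
                       ≡ + 1 * + 1 * (x * x - δ * (y * y))
    identity = solve-∀

  disc-ω : ∀ D → + D * (+ 2 * + 2) ≡ + disc D * (+ ωQ D * + ωQ D)
  disc-ω D with isOneMod4 D
  ... | true  = refl
  ... | false = trans (identity (+ D)) (cong (_* (+ 1 * + 1)) (sym (pos-* 4 D)))
    where
    identity : ∀ δ → δ * (+ 2 * + 2) ≡ + 4 * δ * (+ 1 * + 1)
    identity = solve-∀

  -- For D = Q₀Q₁ + P² and x = (P + √D)/Q₁ this is −Q₁ · N(B − A x).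
  form : ℤ → ℤ → ℤ → ℤ → ℤ → ℤ
  form Q₀ P Q₁ A B = Q₀ * A * A + + 2 * P * A * B - Q₁ * B * B

  Q₀*form≡N√ : ∀ {D} Q₀ P Q₁ A B → D ≡ Q₀ * Q₁ + P * P →
               Q₀ * form Q₀ P Q₁ A B ≡ N√ D (Q₀ * A + P * B) B
  Q₀*form≡N√ Q₀ P Q₁ A B refl = identity Q₀ P Q₁ A B
    where
    identity : ∀ Q₀ P Q₁ A B → Q₀ * (Q₀ * A * A + + 2 * P * A * B - Q₁ * B * B)
                             ≡ (Q₀ * A + P * B) * (Q₀ * A + P * B) - (Q₀ * Q₁ + P * P) * (B * B)
    identity = solve-∀

  Q₁*form≡-N√ : ∀ {D} Q₀ P Q₁ A B → D ≡ Q₀ * Q₁ + P * P →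
                Q₁ * form Q₀ P Q₁ A B ≡ - N√ D (Q₁ * B - P * A) A
  Q₁*form≡-N√ Q₀ P Q₁ A B refl = identity Q₀ P Q₁ A B
    where
    identity : ∀ Q₀ P Q₁ A B → Q₁ * (Q₀ * A * A + + 2 * P * A * B - Q₁ * B * B)
                             ≡ - ((Q₁ * B - P * A) * (Q₁ * B - P * A) - (Q₀ * Q₁ + P * P) * (A * A))
    identity = solve-∀

  -- A α_{m-1} + B α_m: like αs, the index is shifted by one.
  combination : (ℕ → ℕ) → ℤ → ℤ → ℕ → Elt
  combination a A B m = (A * + pp a m + B * + pp a (suc m) , A * + qq a m + B * + qq a (suc m))

  combination-suc : ∀ a A B m → combination a A B (suc m) ≡ combination a B (A + + a (suc m) * B) m
  combination-suc a A B m = cong₂ _,_ (shift (pp a m) (pp a (suc m))) (shift (qq a m) (qq a (suc m)))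
    where
    u = a (suc m)
    identity : ∀ A B u x₀ x₁ → A * x₁ + B * (u * x₁ + x₀) ≡ B * x₀ + (A + u * B) * x₁
    identity = solve-∀
    shift : ∀ x₀ x₁ → A * + x₁ + B * + (u ℕ.* x₁ ℕ.+ x₀) ≡ B * + x₀ + (A + + u * B) * + x₁
    shift x₀ x₁ = trans (cong (λ z → A * + x₁ + B * (z + + x₀)) (pos-* u x₁)) (identity A B (+ u) (+ x₀) (+ x₁))

  αsr-combination : ∀ a m r e f → (e ⊙ αsr a m r) ⊕ (f ⊙ αsr a m (suc r))
                    ≡ combination a (+ e + + f) ((+ e + + f) * + r + + f) m
  αsr-combination a m r e f = cong₂ _,_ (regroup (+ e) (+ f) (+ r) (+ pp a m) (+ pp a (suc m)))
                                        (regroup (+ e) (+ f) (+ r) (+ qq a m) (+ qq a (suc m)))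
    where
    regroup : ∀ e f r x₀ x₁ → e * (x₀ + r * x₁) + f * (x₀ + (1ℤ + r) * x₁)
                            ≡ (e + f) * x₀ + ((e + f) * r + f) * x₁
    regroup = solve-∀

  [-1]^[2*k]≡1 : ∀ k → -1ℤ ^ (2 ℕ.* k) ≡ 1ℤ
  [-1]^[2*k]≡1 k = trans (sym (^-*-assoc -1ℤ 2 k)) (^-zeroˡ k)

  [1+u][e+f]-[[e+f]r+f]≡[d+1]e+df : ∀ {u} r d e f → u ≡ r ℕ.+ d →
    + suc u * (+ e + + f) - ((+ e + + f) * + r + + f) ≡ + ((d ℕ.+ 1) ℕ.* e ℕ.+ d ℕ.* f)
  [1+u][e+f]-[[e+f]r+f]≡[d+1]e+df r d e f refl = begin
    (1ℤ + (+ r + + d)) * (+ e + + f) - ((+ e + + f) * + r + + f) ≡⟨ identity (+ r) (+ d) (+ e) (+ f) ⟩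
    (+ d + 1ℤ) * + e + + d * + f                                 ≡⟨ cong₂ _+_ (pos-* (d ℕ.+ 1) e) (pos-* d f) ⟨
    + ((d ℕ.+ 1) ℕ.* e ℕ.+ d ℕ.* f)                              ∎
    where
    identity : ∀ r d e f → (1ℤ + (r + d)) * (e + f) - ((e + f) * r + f) ≡ (d + 1ℤ) * e + d * f
    identity = solve-∀

  e+f≤[d+2]e+[d+1]f : ∀ d e f → + e + + f ≤ + ((d ℕ.+ 2) ℕ.* e ℕ.+ (d ℕ.+ 1) ℕ.* f)
  e+f≤[d+2]e+[d+1]f d e f = +≤+ (subst (e ℕ.+ f ℕ.≤_) (sym (identity d e f)) (ℕ.m≤m+n (e ℕ.+ f) _))
    where
    identity : ∀ d e f → (d ℕ.+ 2) ℕ.* e ℕ.+ (d ℕ.+ 1) ℕ.* f ≡ e ℕ.+ f ℕ.+ ((d ℕ.+ 1) ℕ.* e ℕ.+ d ℕ.* f)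
    identity = ℕ.solve-∀

  module Expansion {P₀ : ℤ} {Q₀ D : ℕ} {a : ℕ → ℕ} (cf : IsCFExpansion P₀ Q₀ D a) where

    P : ℕ → ℤ
    P = proj₁ cf

    Q : ℕ → ℕ
    Q = proj₁ (proj₂ cf)

    P-zero : P 0 ≡ P₀
    P-zero = proj₁ (proj₂ (proj₂ cf))

    Q-zero : Q 0 ≡ Q₀
    Q-zero = proj₁ (proj₂ (proj₂ (proj₂ cf)))

    steps : ∀ k → (0 ℕ.< Q k) × IsFloor (a k) (P k) (Q k) D
                × (P (suc k) ≡ + a k * + Q k - P k)
                × (+ Q k * + Q (suc k) ≡ + D - P (suc k) * P (suc k))
    steps = proj₂ (proj₂ (proj₂ (proj₂ cf)))

    0<Q : ∀ k → 0ℤ < + Q k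
    0<Q k = +<+ (proj₁ (steps k))

    √D<[1+a]Q-P : ∀ k → SqrtLt D (+ suc (a k) * + Q k - P k)
    √D<[1+a]Q-P k = proj₂ (proj₁ (proj₂ (steps k)))

    P-suc : ∀ k → P (suc k) ≡ + a k * + Q k - P k
    P-suc k = proj₁ (proj₂ (proj₂ (steps k)))

    D≡QQ+PP : ∀ k → + D ≡ + Q k * + Q (suc k) + P (suc k) * P (suc k)
    D≡QQ+PP k = trans (sym (i-j+j≡i (+ D) PP)) (cong (_+ PP) (sym (proj₂ (proj₂ (proj₂ (steps k))))))
      where
      PP = P (suc k) * P (suc k)

    form[_] : ℕ → ℤ → ℤ → ℤ
    form[ m ] = form (+ Q m) (P (suc m)) (+ Q (suc m))

    form[suc]≡-form : ∀ m A B → form[ suc m ] A B ≡ - form[ m ] B (A + + a (suc m) * B)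
    form[suc]≡-form m A B = *-cancelˡ-≡ Q₁ _ _ ⦃ >-nonZero (0<Q (suc m)) ⦄ (begin
      Q₁ * form[ suc m ] A B            ≡⟨ Q₀*form≡N√ Q₁ P₂ (+ Q (suc (suc m))) A B (D≡QQ+PP (suc m)) ⟩
      N√ (+ D) (Q₁ * A + P₂ * B) B      ≡⟨ cong (λ t → N√ (+ D) t B) Q₁A+P₂B≡Q₁A′-P₁B ⟩
      N√ (+ D) (Q₁ * A′ - P₁ * B) B     ≡⟨ neg-involutive _ ⟨
      - - N√ (+ D) (Q₁ * A′ - P₁ * B) B ≡⟨ cong -_ (Q₁*form≡-N√ (+ Q m) P₁ Q₁ B A′ (D≡QQ+PP m)) ⟨
      - (Q₁ * form[ m ] B A′)           ≡⟨ neg-distribʳ-* Q₁ _ ⟩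
      Q₁ * - form[ m ] B A′             ∎)
      where
      Q₁ = + Q (suc m)
      P₁ = P (suc m)
      P₂ = P (suc (suc m))
      A′ = A + + a (suc m) * B
      identity : ∀ Q A B u P → Q * A + (u * Q - P) * B ≡ Q * (A + u * B) - P * B
      identity = solve-∀
      Q₁A+P₂B≡Q₁A′-P₁B : Q₁ * A + P₂ * B ≡ Q₁ * A′ - P₁ * B
      Q₁A+P₂B≡Q₁A′-P₁B = trans (cong (λ p → Q₁ * A + p * B) (P-suc (suc m))) (identity Q₁ A B (+ a (suc m)) P₁)

    scaledNorm-combination : ∀ m A B → scaledNorm (P 0) (Q 0) D (combination a A B m)
                                       ≡ -1ℤ ^ m * (+ Q 0 * form[ m ] A B)
    scaledNorm-combination zero A B = begin
      N√ (+ D) (+ Q 0 * (A * + 1 + B * + a 0) - P 0 * (A * + 0 + B * + 1)) (A * + 0 + B * + 1)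
        ≡⟨ cong₂ (N√ (+ D)) (regroup (+ Q 0) (P 0) A B (+ a 0)) (identity A B) ⟩
      N√ (+ D) (+ Q 0 * A + (+ a 0 * + Q 0 - P 0) * B) B
        ≡⟨ cong (λ p → N√ (+ D) (+ Q 0 * A + p * B) B) (P-suc 0) ⟨
      N√ (+ D) (+ Q 0 * A + P 1 * B) B
        ≡⟨ Q₀*form≡N√ (+ Q 0) (P 1) (+ Q 1) A B (D≡QQ+PP 0) ⟨
      + Q 0 * form[ 0 ] A B
        ≡⟨ *-identityˡ _ ⟨
      1ℤ * (+ Q 0 * form[ 0 ] A B)
        ∎
      where
      regroup : ∀ Q P A B u → Q * (A * + 1 + B * u) - P * (A * + 0 + B * + 1) ≡ Q * A + (u * Q - P) * B
      regroup = solve-∀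
      identity : ∀ A B → A * + 0 + B * + 1 ≡ B
      identity = solve-∀
    scaledNorm-combination (suc m) A B = begin
      scaledNorm (P 0) (Q 0) D (combination a A B (suc m))
        ≡⟨ cong (scaledNorm (P 0) (Q 0) D) (combination-suc a A B m) ⟩
      scaledNorm (P 0) (Q 0) D (combination a B A′ m)
        ≡⟨ scaledNorm-combination m B A′ ⟩
      -1ℤ ^ m * (+ Q 0 * form[ m ] B A′)
        ≡⟨ flip-sign (-1ℤ ^ m) (+ Q 0) (form[ m ] B A′) ⟩
      -1ℤ ^ suc m * (+ Q 0 * - form[ m ] B A′)
        ≡⟨ cong (λ h → -1ℤ ^ suc m * (+ Q 0 * h)) (form[suc]≡-form m A B) ⟨
      -1ℤ ^ suc m * (+ Q 0 * form[ suc m ] A B)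
        ∎
      where
      A′ = A + + a (suc m) * B
      flip-sign : ∀ s q h → s * (q * h) ≡ -1ℤ * s * (q * - h)
      flip-sign = solve-∀

    scaledNorm-combination-even : ∀ k A B → scaledNorm (P 0) (Q 0) D (combination a A B (2 ℕ.* k))
                                            ≡ + Q 0 * form[ 2 ℕ.* k ] A B
    scaledNorm-combination-even k A B =
      trans (scaledNorm-combination (2 ℕ.* k) A B)
            (trans (cong (_* (+ Q 0 * form[ 2 ℕ.* k ] A B)) ([-1]^[2*k]≡1 k)) (*-identityˡ _))

    form-<√ : 0ℤ < + D → ∀ m {A} B → 0ℤ < A → form[ m ] A B <√[ + D ]· + 2 * A * (+ suc (a (suc m)) * A - B)
    form-<√ 0<D m {A} B 0<A = *-cancelˡ-<√ {d = + D} {y = + 2 * A * (u * A - B)} (0<Q (suc m))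
      (subst₂ _<√[ + D ]·_ DA²-L²≡Q₁*form 2A[cA-L]≡Q₁*2A[uA-B] (DA²-L²<√D·2A[cA-L] L 0<D 0<c D<c² 0<A))
      where
      Q₁ = + Q (suc m)
      P₁ = P (suc m)
      u  = + suc (a (suc m))
      L  = Q₁ * B - P₁ * A
      0<c : 0ℤ < u * Q₁ - P₁
      0<c = proj₁ (√D<[1+a]Q-P (suc m))
      D<c² : + D < (u * Q₁ - P₁) * (u * Q₁ - P₁)
      D<c² = proj₂ (√D<[1+a]Q-P (suc m))
      negate : ∀ D L A → D * (A * A) - L * L ≡ - (L * L - D * (A * A))
      negate = solve-∀
      DA²-L²≡Q₁*form : + D * (A * A) - L * L ≡ Q₁ * form[ m ] A B
      DA²-L²≡Q₁*form = trans (negate (+ D) L A) (sym (Q₁*form≡-N√ (+ Q m) P₁ Q₁ A B (D≡QQ+PP m)))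
      identity : ∀ Q₁ P₁ u A B → + 2 * A * ((u * Q₁ - P₁) * A - (Q₁ * B - P₁ * A)) ≡ Q₁ * (+ 2 * A * (u * A - B))
      identity = solve-∀
      2A[cA-L]≡Q₁*2A[uA-B] : + 2 * A * ((u * Q₁ - P₁) * A - L) ≡ Q₁ * (+ 2 * A * (u * A - B))
      2A[cA-L]≡Q₁*2A[uA-B] = identity Q₁ P₁ u A B

  norm-αsr-bound : ∀ {D a} → 0 ℕ.< D → IsCFω D a → ∀ k r d e f → a (suc (2 ℕ.* k)) ≡ r ℕ.+ d → 1 ℕ.≤ e →
                   LtSqrtMul (norm D ((e ⊙ αsr a (2 ℕ.* k) r) ⊕ (f ⊙ αsr a (2 ℕ.* k) (suc r))))
                             (disc D)
                             (((d ℕ.+ 2) ℕ.* e ℕ.+ (d ℕ.+ 1) ℕ.* f) ℕ.* ((d ℕ.+ 1) ℕ.* e ℕ.+ d ℕ.* f))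
  norm-αsr-bound {D} {a} 0<D cf k r d e f u≡r+d 1≤e =
    <√⇒LtSqrtMul {d = disc D} {m = X ℕ.* Y} (subst (N <√[ + disc D ]·_) (sym (pos-* X Y))
      (*-cancelˡ-<√ {d = + disc D} {y = + X * + Y} (0<Q 0)
        (<√-rescale {d = + D} {k = + 2} {d′ = + disc D} {q = + Q 0} {y = + X * + Y} disc-Q₀
          (<√-monoʳ {d = + D} (+≤+ z≤n) 0≤2AY 2AY≤2XY
            (subst₂ _<√[ + D ]·_ form≡Q₀N (cong (+ 2 * A *_) [1+u]A-B≡Y) (form-<√ (+<+ 0<D) m B 0<A))))))
    where
    open Expansion {ωP D} {ωQ D} {D} {a} cf
    m = 2 ℕ.* k
    α = (e ⊙ αsr a m r) ⊕ (f ⊙ αsr a m (suc r))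
    N = norm D α
    A = + e + + f
    B = A * + r + + f
    X = (d ℕ.+ 2) ℕ.* e ℕ.+ (d ℕ.+ 1) ℕ.* f
    Y = (d ℕ.+ 1) ℕ.* e ℕ.+ d ℕ.* f

    Q₀²N≡scaledNorm : + Q 0 * + Q 0 * N ≡ scaledNorm (P 0) (Q 0) D α
    Q₀²N≡scaledNorm = subst₂ (λ p q → + q * + q * N ≡ scaledNorm p q D α) (sym P-zero) (sym Q-zero)
                             (sym (scaledNorm-ω D α))

    form≡Q₀N : form[ m ] A B ≡ + Q 0 * N
    form≡Q₀N = sym (*-cancelˡ-≡ (+ Q 0) _ _ ⦃ >-nonZero (0<Q 0) ⦄ (begin
      + Q 0 * (+ Q 0 * N)                            ≡⟨ *-assoc (+ Q 0) (+ Q 0) N ⟨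
      + Q 0 * + Q 0 * N                              ≡⟨ Q₀²N≡scaledNorm ⟩
      scaledNorm (P 0) (Q 0) D α                     ≡⟨ cong (scaledNorm (P 0) (Q 0) D) (αsr-combination a m r e f) ⟩
      scaledNorm (P 0) (Q 0) D (combination a A B m) ≡⟨ scaledNorm-combination-even k A B ⟩
      + Q 0 * form[ m ] A B                          ∎))

    disc-Q₀ : + D * (+ 2 * + 2) ≡ + disc D * (+ Q 0 * + Q 0)
    disc-Q₀ = subst (λ q → + D * (+ 2 * + 2) ≡ + disc D * (+ q * + q)) (sym Q-zero) (disc-ω D)

    [1+u]A-B≡Y : + suc (a (suc m)) * A - B ≡ + Y
    [1+u]A-B≡Y = [1+u][e+f]-[[e+f]r+f]≡[d+1]e+df r d e f u≡r+d

    0<A : 0ℤ < A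
    0<A = +<+ (ℕ.≤-trans 1≤e (ℕ.m≤m+n e f))

    0≤2AY : 0ℤ ≤ + 2 * A * + Y
    0≤2AY = 0≤i*j {+ 2 * A} {+ Y} (0≤i*j {+ 2} {A} (+≤+ z≤n) (<⇒≤ 0<A)) (+≤+ z≤n)

    2AY≤2XY : + 2 * A * + Y ≤ + 2 * (+ X * + Y)
    2AY≤2XY = subst (_≤ + 2 * (+ X * + Y)) (sym (*-assoc (+ 2) A (+ Y)))
                (*-monoˡ-≤-nonNeg (+ 2) (*-monoʳ-≤-nonNeg (+ Y) (e+f≤[d+2]e+[d+1]f d e f)))

open ContinuedFractionNorms using (norm-αsr-bound)
open import Data.Nat using (ℕ; suc; _+_; _*_; _∸_; _≤_; _<_; z<s)
open import Data.Nat.Properties using (<-≤-trans; <⇒≤; m+[n∸m]≡n)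
open import Relation.Binary.PropositionalEquality using (sym)

lemma4p4 : (D : ℕ) → 2 ≤ D → SquareFree D →
           (a : ℕ → ℕ) → IsCFω D a →
           (k r e f : ℕ) → r < a (suc (2 * k)) → 1 ≤ e →
           LtSqrtMul
             (norm D ((e ⊙ αsr a (2 * k) r) ⊕ (f ⊙ αsr a (2 * k) (suc r))))
             (disc D)
             (((a (suc (2 * k)) ∸ r + 2) * e + (a (suc (2 * k)) ∸ r + 1) * f)
              * ((a (suc (2 * k)) ∸ r + 1) * e + (a (suc (2 * k)) ∸ r) * f))
lemma4p4 D 2≤D _ a cf k r e f r<u 1≤e =
  norm-αsr-bound (<-≤-trans z<s 2≤D) cf k r (a (suc (2 * k)) ∸ r) e f (sym (m+[n∸m]≡n (<⇒≤ r<u))) 1≤e
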